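{- Let $\mathcal{C}$ be a gs-monoidal category with objects $T,C$ and a behavior structure $(\Phi,\overline B,\overline{\mathrm{eval}},=)$ whose behavioral relation is equality on $\overline B$, and let $\succeq$ be the corresponding ambient imitation relation. Then for all $f,g\colon A\to T\otimes C$, $$f\succeq g\iff \overline{\mathrm{eval}}\circ\overline f\ \sqsupseteq\ \overline{\mathrm{eval}}\circ\overline g,$$ where on the right $\sqsupseteq$ is taken in $\mathbf{Rel}$, i.e. $(\overline{\mathrm{eval}}\circ\overline f)\circ\mathrm{dom}(\overline{\mathrm{eval}}\circ\overline g)=\overline{\mathrm{eval}}\circ\overline g$.
   Context: A gs-monoidal category is a symmetric monoidal category (tensor $\otimes$, unit $I$) whose objects carry commutative comonoids $\mathrm{copy}_A$, $\mathrm{del}_A\colon A\to I$ compatible with $\otimes$, $\mathrm{del}_I=\mathrm{id}_I$. $\mathbf{Rel}$ is the category of sets and relations (cartesian product, $\mathrm{copy}(a)=\{(a,a)\}$, $\mathrm{del}$ the full relation to a singleton). For a relation $\mu\colon A\to X$, $\mathrm{dom}(\mu)\colon A\to A$ is the restriction of $\mathrm{id}_A$ to $\{a:\mu(a)\ne\emptyset\}$, and $\nu\sqsupseteq\mu$ means $\nu\circ\mathrm{dom}(\mu)=\mu$. A lax gs-monoidal functor $\Phi\colon\mathcal{C}\to\mathbf{Rel}$ is a lax symmetric monoidal functor whose structure maps $\psi_0,\psi_{A,B}$ satisfy $\Phi(\mathrm{copy}_A)=\psi_{A,A}\circ\mathrm{copy}_{\Phi A}$, $\Phi(\mathrm{del}_A)=\psi_0\circ\mathrm{del}_{\Phi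 A}$; $\overline X=\Phi(X)$, $\overline f=\Phi(f)$. A behavior structure $(\Phi,\overline B,\overline{\mathrm{eval}},\succeq_B)$: a lax gs-monoidal $\Phi$, a set $\overline B$, a function $\overline{\mathrm{eval}}\colon\overline{T\otimes C}\to\overline B$, a preorder $\succeq_B$ on $\overline B$. Imitation: $\nu\succeq^{\rm im}\mu$ for relations $\nu,\mu\colon A\to\overline B$ iff for every $a$ with $\mu(a)\ne\emptyset$ there are functions $\mathrm{enh}\colon\mu(a)\to\nu(a)$ with $\mathrm{enh}(u)\succeq_B u$ and $\mathrm{deg}\colon\nu(a)\to\mu(a)$ with $v\succeq_B\mathrm{deg}(v)$. Ambient imitation relation: $f\succeq g$ iff $\overline{\mathrm{eval}}\circ\overline f\succeq^{\rm im}\overline{\mathrm{eval}}\circ\overline g$. -}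

module Defs where

open import Level using (Level; _⊔_; 0ℓ) renaming (suc to lsuc)
open import Data.Product using (Σ; ∃; _×_; _,_; proj₁; proj₂; swap)
open import Data.Unit using (⊤; tt)
open import Function.Bundles using (_⇔_)
open import Relation.Binary.Core using (Rel)
open import Relation.Binary.Structures using (IsEquivalence; IsPreorder)
open import Relation.Binary.PropositionalEquality using (_≡_)

Rl : Set → Set → Set₁
Rl A B = A → B → Set

_≐_ : {A B : Set} → Rl A B → Rl A B → Set
R ≐ S = ∀ a b → R a b ⇔ S a b
infix 4 _≐_

idᴿ : {A : Set} → Rl A A
idᴿ a a' = a ≡ a'

_∘ᴿ_ : {A B C : Set} → Rl B C → Rl A B → Rl A C
(S ∘ᴿ R) a c = ∃ λ b → R a b × S b c
infixr 9 _∘ᴿ_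

graph : {A B : Set} → (A → B) → Rl A B
graph f a b = f a ≡ b

_⊗ᴿ_ : {A B C D : Set} → Rl A B → Rl C D → Rl (A × C) (B × D)
(R ⊗ᴿ S) (a , c) (b , d) = R a b × S c d
infixr 10 _⊗ᴿ_

assocˢ : {A B C : Set} → (A × B) × C → A × (B × C)
assocˢ ((a , b) , c) = a , (b , c)

copyᴿ : {A : Set} → Rl A (A × A)
copyᴿ = graph (λ a → a , a)

delᴿ : {A : Set} → Rl A ⊤
delᴿ _ _ = ⊤

dom : {A X : Set} → Rl A X → Rl A A
dom μ a a' = (a ≡ a') × (∃ λ x → μ a x)

_⊒_ : {A X : Set} → Rl A X → Rl A X → Set
ν ⊒ μ = ν ∘ᴿ dom μ ≐ μ
infix 4 _⊒_

record Category (o ℓ e : Level) : Set (lsuc (o ⊔ ℓ ⊔ e)) where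
  infix  4 _≈_ _⇒_
  infixr 9 _∘_
  field
    Obj : Set o
    _⇒_ : Obj → Obj → Set ℓ
    _≈_ : ∀ {A B} → Rel (A ⇒ B) e
    id  : ∀ {A} → A ⇒ A
    _∘_ : ∀ {A B C} → B ⇒ C → A ⇒ B → A ⇒ C
    equiv     : ∀ {A B} → IsEquivalence (_≈_ {A} {B})
    ∘-resp-≈  : ∀ {A B C} {f h : B ⇒ C} {g i : A ⇒ B} →
                f ≈ h → g ≈ i → f ∘ g ≈ h ∘ i
    assoc     : ∀ {A B C D} {f : A ⇒ B} {g : B ⇒ C} {h : C ⇒ D} →
                (h ∘ g) ∘ f ≈ h ∘ (g ∘ f)
    identityˡ : ∀ {A B} {f : A ⇒ B} → id ∘ f ≈ f
    identityʳ : ∀ {A B} {f : A ⇒ B} → f ∘ id ≈ f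

record SymmetricMonoidal {o ℓ e} (𝒞 : Category o ℓ e) : Set (o ⊔ ℓ ⊔ e) where
  open Category 𝒞
  infixr 10 _⊗₀_ _⊗₁_
  field
    _⊗₀_ : Obj → Obj → Obj
    _⊗₁_ : ∀ {A B C D} → A ⇒ B → C ⇒ D → (A ⊗₀ C) ⇒ (B ⊗₀ D)
    unit : Obj
    ⊗-resp-≈      : ∀ {A B C D} {f f' : A ⇒ B} {g g' : C ⇒ D} →
                    f ≈ f' → g ≈ g' → f ⊗₁ g ≈ f' ⊗₁ g'
    ⊗-identity    : ∀ {A B} → id {A} ⊗₁ id {B} ≈ id
    ⊗-homomorphism : ∀ {A B C D E F} {f : A ⇒ B} {g : B ⇒ C} {h : D ⇒ E} {i : E ⇒ F} →
                    (g ∘ f) ⊗₁ (i ∘ h) ≈ (g ⊗₁ i) ∘ (f ⊗₁ h)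
    α⇒ : ∀ {A B C} → (A ⊗₀ B) ⊗₀ C ⇒ A ⊗₀ (B ⊗₀ C)
    α⇐ : ∀ {A B C} → A ⊗₀ (B ⊗₀ C) ⇒ (A ⊗₀ B) ⊗₀ C
    α-isoˡ : ∀ {A B C} → α⇐ ∘ α⇒ {A} {B} {C} ≈ id
    α-isoʳ : ∀ {A B C} → α⇒ ∘ α⇐ {A} {B} {C} ≈ id
    α-natural : ∀ {A B C D E F} {f : A ⇒ D} {g : B ⇒ E} {h : C ⇒ F} →
                α⇒ ∘ ((f ⊗₁ g) ⊗₁ h) ≈ (f ⊗₁ (g ⊗₁ h)) ∘ α⇒
    λ⇒ : ∀ {A} → unit ⊗₀ A ⇒ A
    λ⇐ : ∀ {A} → A ⇒ unit ⊗₀ A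
    λ-isoˡ : ∀ {A} → λ⇐ ∘ λ⇒ {A} ≈ id
    λ-isoʳ : ∀ {A} → λ⇒ ∘ λ⇐ {A} ≈ id
    λ-natural : ∀ {A B} {f : A ⇒ B} → λ⇒ ∘ (id ⊗₁ f) ≈ f ∘ λ⇒
    ρ⇒ : ∀ {A} → A ⊗₀ unit ⇒ A
    ρ⇐ : ∀ {A} → A ⇒ A ⊗₀ unit
    ρ-isoˡ : ∀ {A} → ρ⇐ ∘ ρ⇒ {A} ≈ id
    ρ-isoʳ : ∀ {A} → ρ⇒ ∘ ρ⇐ {A} ≈ id
    ρ-natural : ∀ {A B} {f : A ⇒ B} → ρ⇒ ∘ (f ⊗₁ id) ≈ f ∘ ρ⇒
    σ : ∀ {A B} → A ⊗₀ B ⇒ B ⊗₀ A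
    σ-natural : ∀ {A B C D} {f : A ⇒ B} {g : C ⇒ D} →
                σ ∘ (f ⊗₁ g) ≈ (g ⊗₁ f) ∘ σ
    σ-involutive : ∀ {A B} → σ {B} {A} ∘ σ {A} {B} ≈ id
    pentagon : ∀ {A B C D} →
               (id {A} ⊗₁ α⇒ {B} {C} {D}) ∘ α⇒ ∘ (α⇒ ⊗₁ id) ≈ α⇒ ∘ α⇒
    triangle : ∀ {A B} → (id {A} ⊗₁ λ⇒ {B}) ∘ α⇒ ≈ ρ⇒ ⊗₁ id
    hexagon  : ∀ {A B C} →
               (id {B} ⊗₁ σ {A} {C}) ∘ α⇒ ∘ (σ ⊗₁ id) ≈ α⇒ ∘ σ ∘ α⇒

record GSMonoidal {o ℓ e} {𝒞 : Category o ℓ e} (M : SymmetricMonoidal 𝒞)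
       : Set (o ⊔ ℓ ⊔ e) where
  open Category 𝒞
  open SymmetricMonoidal M
  field
    copy : ∀ {A} → A ⇒ A ⊗₀ A
    del  : ∀ {A} → A ⇒ unit
    counitˡ : ∀ {A} → λ⇒ ∘ (del ⊗₁ id) ∘ copy {A} ≈ id
    counitʳ : ∀ {A} → ρ⇒ ∘ (id ⊗₁ del) ∘ copy {A} ≈ id
    coassoc : ∀ {A} → α⇒ ∘ (copy ⊗₁ id) ∘ copy {A} ≈ (id ⊗₁ copy) ∘ copy
    cocomm  : ∀ {A} → σ ∘ copy {A} ≈ copy
    copy-⊗  : ∀ {A B} →
              copy {A ⊗₀ B} ≈
                α⇐ ∘ (id ⊗₁ α⇒) ∘ (id ⊗₁ (σ ⊗₁ id)) ∘ (id ⊗₁ α⇐) ∘ α⇒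
                  ∘ (copy {A} ⊗₁ copy {B})
    del-⊗   : ∀ {A B} → del {A ⊗₀ B} ≈ λ⇒ ∘ (del {A} ⊗₁ del {B})
    del-unit : del {unit} ≈ id

record LaxGSFunctor {o ℓ e} {𝒞 : Category o ℓ e} {M : SymmetricMonoidal 𝒞}
       (G : GSMonoidal M) : Set (lsuc 0ℓ ⊔ o ⊔ ℓ ⊔ e) where
  open Category 𝒞
  open SymmetricMonoidal M
  open GSMonoidal G
  field
    F₀ : Obj → Set
    F₁ : ∀ {A B} → A ⇒ B → Rl (F₀ A) (F₀ B)
    F-resp-≈ : ∀ {A B} {f g : A ⇒ B} → f ≈ g → F₁ f ≐ F₁ g
    F-identity : ∀ {A} → F₁ (id {A}) ≐ idᴿ
    F-homomorphism : ∀ {A B C} {f : A ⇒ B} {g : B ⇒ C} →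
                     F₁ (g ∘ f) ≐ F₁ g ∘ᴿ F₁ f
    ψ₀ : Rl ⊤ (F₀ unit)
    ψ  : ∀ {A B} → Rl (F₀ A × F₀ B) (F₀ (A ⊗₀ B))
    ψ-natural : ∀ {A B C D} {f : A ⇒ B} {g : C ⇒ D} →
                F₁ (f ⊗₁ g) ∘ᴿ ψ ≐ ψ ∘ᴿ (F₁ f ⊗ᴿ F₁ g)
    ψ-assoc : ∀ {A B C} →
              F₁ (α⇒ {A} {B} {C}) ∘ᴿ ψ ∘ᴿ (ψ ⊗ᴿ idᴿ) ≐ ψ ∘ᴿ (idᴿ ⊗ᴿ ψ) ∘ᴿ graph assocˢ
    ψ-unitˡ : ∀ {A} → F₁ (λ⇒ {A}) ∘ᴿ ψ ∘ᴿ (ψ₀ ⊗ᴿ idᴿ) ≐ graph proj₂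
    ψ-unitʳ : ∀ {A} → F₁ (ρ⇒ {A}) ∘ᴿ ψ ∘ᴿ (idᴿ ⊗ᴿ ψ₀) ≐ graph proj₁
    ψ-braiding : ∀ {A B} → F₁ (σ {A} {B}) ∘ᴿ ψ ≐ ψ ∘ᴿ graph swap
    F-copy : ∀ {A} → F₁ (copy {A}) ≐ ψ ∘ᴿ copyᴿ
    F-del  : ∀ {A} → F₁ (del {A}) ≐ ψ₀ ∘ᴿ delᴿ

record BehaviorStructure {o ℓ e} {𝒞 : Category o ℓ e} {M : SymmetricMonoidal 𝒞}
       (G : GSMonoidal M) (T C : Category.Obj 𝒞) : Set (lsuc 0ℓ ⊔ o ⊔ ℓ ⊔ e) where
  open SymmetricMonoidal M
  field
    Φ     : LaxGSFunctor G
  open LaxGSFunctor Φ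
  field
    B̄     : Set
    eval̄  : F₀ (T ⊗₀ C) → B̄
    _≽B_  : B̄ → B̄ → Set
    ≽B-isPreorder : IsPreorder _≡_ _≽B_

Imitates : {A B̄ : Set} → (B̄ → B̄ → Set) → Rl A B̄ → Rl A B̄ → Set
Imitates {A} {B̄} _≽_ ν μ =
  ∀ a → (∃ λ u → μ a u) →
    (Σ (Σ B̄ (μ a) → Σ B̄ (ν a)) λ enh → ∀ u → proj₁ (enh u) ≽ proj₁ u)
    × (Σ (Σ B̄ (ν a) → Σ B̄ (μ a)) λ deg → ∀ v → proj₁ v ≽ proj₁ (deg v))

module _ {o ℓ e} {𝒞 : Category o ℓ e} {M : SymmetricMonoidal 𝒞}
         {G : GSMonoidal M} {T C : Category.Obj 𝒞} where
  open Category 𝒞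
  open SymmetricMonoidal M

  evalAfter : (BS : BehaviorStructure G T C) → ∀ {A} → A ⇒ (T ⊗₀ C) →
              Rl (LaxGSFunctor.F₀ (BehaviorStructure.Φ BS) A) (BehaviorStructure.B̄ BS)
  evalAfter BS f = graph eval̄ ∘ᴿ LaxGSFunctor.F₁ Φ f
    where open BehaviorStructure BS

  AmbientImitation : (BS : BehaviorStructure G T C) → ∀ {A} →
                     A ⇒ (T ⊗₀ C) → A ⇒ (T ⊗₀ C) → Set
  AmbientImitation BS f g =
    Imitates (BehaviorStructure._≽B_ BS) (evalAfter BS f) (evalAfter BS g)

module Submission where

open import Defs
open import Data.Product using (Σ; _,_; proj₁; proj₂)
open import Function.Bundles using (_⇔_; mk⇔; Equivalence)
open import Relation.Binary.PropositionalEquality using (_≡_; refl; sym; subst)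

-- With equality as the behavioral relation, enh and deg must preserve outputs,
-- so imitation says exactly that ν and μ have the same outputs wherever μ is defined.

module _ {A B̄ : Set} {ν μ : Rl A B̄} where

  ∘ᴿ-dom⇒ : ∀ {a b} → (ν ∘ᴿ dom μ) a b → ν a b
  ∘ᴿ-dom⇒ (_ , (refl , _) , νab) = νab

  ⊒⇒imitates-≡ : ν ⊒ μ → Imitates _≡_ ν μ
  ⊒⇒imitates-≡ ν⊒μ a μa≢∅ = (enh , λ _ → refl) , (deg , λ _ → refl)
    where
    enh : Σ B̄ (μ a) → Σ B̄ (ν a)
    enh (u , μau) = u , ∘ᴿ-dom⇒ (Equivalence.from (ν⊒μ a u) μau)
    deg : Σ B̄ (ν a) → Σ B̄ (μ a)
    deg (v , νav) = v , Equivalence.to (ν⊒μ a v) (a , (refl , μa≢∅) , νav)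

  imitates-≡⇒⊒ : Imitates _≡_ ν μ → ν ⊒ μ
  imitates-≡⇒⊒ im a b = mk⇔ restricted⇒μ μ⇒restricted
    where
    restricted⇒μ : (ν ∘ᴿ dom μ) a b → μ a b
    restricted⇒μ (_ , (refl , μa≢∅) , νab) with proj₂ (im a μa≢∅)
    ... | deg , deg-eq = subst (μ a) (sym (deg-eq (b , νab))) (proj₂ (deg (b , νab)))

    μ⇒restricted : μ a b → (ν ∘ᴿ dom μ) a b
    μ⇒restricted μab with proj₁ (im a (b , μab))
    ... | enh , enh-eq =
      a , (refl , (b , μab)) , subst (ν a) (enh-eq (b , μab)) (proj₂ (enh (b , μab)))

  imitates-≡⇔⊒ : Imitates _≡_ ν μ ⇔ ν ⊒ μ
  imitates-≡⇔⊒ = mk⇔ imitates-≡⇒⊒ ⊒⇒imitates-≡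

mainTheorem16 : ∀ {o ℓ e} {𝒞 : Category o ℓ e} {M : SymmetricMonoidal 𝒞}
                  {G : GSMonoidal M} {T C : Category.Obj 𝒞}
                  (BS : BehaviorStructure G T C) →
                  BehaviorStructure._≽B_ BS ≡ _≡_ →
                  ∀ {A : Category.Obj 𝒞}
                    (f g : Category._⇒_ 𝒞 A (SymmetricMonoidal._⊗₀_ M T C)) →
                  AmbientImitation BS f g ⇔ (evalAfter BS f ⊒ evalAfter BS g)
mainTheorem16 BS ≽B≡≡ f g
  rewrite ≽B≡≡ = imitates-≡⇔⊒ {ν = evalAfter BS f} {μ = evalAfter BS g}
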